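{- For every positive integer $n$ and every $\pi\in\Pi(n)$, $|S^{M}_{\mathrm{out}}(\pi)\cap S^{M}_{\mathrm{in}}(\pi)| = n$.
   Context: $\Pi(n)$ denotes the set of permutations of $\{1,\dots,n\}$, each regarded as a sequence $\pi=(\pi_1,\dots,\pi_n)$. A mirror TDRL (MTDRL) operation on $\pi$ is specified by a binary pattern $b\in\{0,1\}^n$. Its result is the concatenation of $(\pi_i:b_i=1)$, with indices in increasing order, followed by $(\pi_i:b_i=0)$, with indices in decreasing order. $S^{M}_{\mathrm{out}}(\pi)$ is the set of all sequences obtainable from $\pi$ by one MTDRL operation. $S^{M}_{\mathrm{in}}(\pi)=\{\rho\in\Pi(n):\pi\in S^{M}_{\mathrm{out}}(\rho)\}$. -}

module Defs where

open import Data.Nat using (ℕ)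
open import Data.Fin using (Fin)
open import Data.Bool using (Bool; true; false)
open import Data.List using (List; []; _∷_; _++_; reverse; length)
open import Data.List.Relation.Unary.Unique.Propositional using (Unique)
open import Data.List.Membership.Propositional using (_∈_)
open import Data.Vec using (Vec; lookup; toList)
open import Data.Vec as Vec using ()
open import Data.Product using (_×_; ∃)
open import Function.Bundles using (_⇔_)
open import Relation.Binary.PropositionalEquality using (_≡_)

-- Π(n): permutations of {1,…,n}, encoded on Fin n = {0,…,n-1} as
-- sequences of length n with pairwise distinct entries.
IsPerm : (n : ℕ) → Vec (Fin n) n → Set
IsPerm n π = ∀ i j → lookup π i ≡ lookup π j → i ≡ j

ones : {A : Set} {n : ℕ} → Vec A n → Vec Bool n → List A
ones Vec.[] Vec.[] = []
ones (x Vec.∷ xs) (true Vec.∷ bs) = x ∷ ones xs bs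
ones (x Vec.∷ xs) (false Vec.∷ bs) = ones xs bs

zeros : {A : Set} {n : ℕ} → Vec A n → Vec Bool n → List A
zeros Vec.[] Vec.[] = []
zeros (x Vec.∷ xs) (true Vec.∷ bs) = zeros xs bs
zeros (x Vec.∷ xs) (false Vec.∷ bs) = x ∷ zeros xs bs

mtdrl : {A : Set} {n : ℕ} → Vec A n → Vec Bool n → List A
mtdrl π b = ones π b ++ reverse (zeros π b)

InOut : {n : ℕ} → Vec (Fin n) n → Vec (Fin n) n → Set
InOut {n} π ρ = ∃ λ (b : Vec Bool n) → mtdrl π b ≡ toList ρ

InIn : {n : ℕ} → Vec (Fin n) n → Vec (Fin n) n → Set
InIn {n} π ρ = IsPerm n ρ × InOut ρ π

InBoth : {n : ℕ} → Vec (Fin n) n → Vec (Fin n) n → Set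
InBoth π ρ = InOut π ρ × InIn π ρ

HasCard : {A : Set} → (A → Set) → ℕ → Set
HasCard {A} P k = ∃ λ (L : List A) → Unique L × length L ≡ k × (∀ x → (x ∈ L) ⇔ P x)

module Submission where

-- For k ∈ ℕ let rₖ(π) keep the first k entries of π in place and
-- reverse the remaining ones (r₀(π) is the reversal, rₖ(π) = π once k ≥ n - 1).
--  (1) Every rₖ(π) lies in S_out(π) ∩ S_in(π): the pattern 1ᵏ0ⁿ⁻ᵏ sends π to
--      rₖ(π) and, since rₖ is an involution, sends rₖ(π) back to π.
--  (2) Conversely, if ρ = MTDRL(π, b) and π = MTDRL(ρ, c) with π repetition-free,
--      then ρ = rₖ(π) for some k.  By induction on π = x ∷ π′: if b₁ = 1 then
--      ρ = x ∷ ρ′ and either c₁ = 1 (recurse) or c₁ = 0, which moves x to the end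
--      of π and forces π = [x].  If b₁ = 0 then x is the last entry of ρ; every
--      MTDRL of ρ puts x directly behind the selected entries, and as x heads π
--      nothing is selected, so π′ is the reversal of the rest: ρ = r₀(π).
--  (3) r₀(π), …, rₙ₋₁(π) are pairwise distinct.
-- So the list [r₀(π), …, rₙ₋₁(π)] witnesses that the intersection has n elements.

open import Defs
open import Data.Nat using (ℕ; zero; suc; _≤_; _<_; s≤s)
open import Data.Nat.Properties using (n≮0; _<?_; ≮⇒≥; ≤-refl; ≤-trans; n≤1+n)
open import Data.Fin using (Fin)
open import Data.Bool using (Bool; true; false)
open import Data.Vec using (Vec)
import Data.Vec as V
import Data.Vec.Properties as VP
import Data.Vec.Relation.Unary.All.Properties as VAll
import Data.Vec.Relation.Unary.Unique.Propositional as VU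
import Data.Vec.Relation.Unary.Unique.Propositional.Properties as VUP
open import Data.Vec.Relation.Unary.AllPairs using ([]; _∷_)
open import Data.List using (List; []; _∷_; _++_; _∷ʳ_; reverse; length; applyUpTo; [_])
import Data.List.Properties as LP
open import Data.List.Relation.Unary.All using (All; []; _∷_)
import Data.List.Relation.Unary.All as All
open import Data.List.Relation.Unary.AllPairs using ([]; _∷_)
open import Data.List.Relation.Unary.Unique.Propositional using (Unique)
import Data.List.Relation.Unary.Unique.Propositional.Properties as UP
open import Data.List.Membership.Propositional using (_∈_)
import Data.List.Membership.Propositional.Properties as MP
open import Data.List.Relation.Unary.Any using (here)
open import Data.List.Relation.Binary.Permutation.Propositional using (_↭_; ↭-refl; ↭-prep; ↭-sym; ↭⇒↭ₛ)
open import Data.List.Relation.Binary.Permutation.Propositional.Properties using (∈-resp-↭; ↭-reverse)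
import Data.List.Relation.Binary.Permutation.Setoid.Properties as PermS
open import Data.Product using (_×_; _,_; ∃; proj₂)
open import Data.Sum using (_⊎_; inj₁; inj₂)
open import Data.Empty using (⊥-elim)
open import Relation.Nullary using (yes; no)
open import Relation.Binary.PropositionalEquality hiding ([_])
open import Function.Bundles using (mk⇔)

prefixPattern : ℕ → (n : ℕ) → Vec Bool n
prefixPattern zero n = V.replicate n false
prefixPattern (suc k) zero = V.[]
prefixPattern (suc k) (suc n) = true V.∷ prefixPattern k n

module _ {A : Set} where

  -- MTDRL on lists.  The pattern is read bit by bit; entries beyond the end of
  -- the pattern count as 0, so the empty pattern reverses the whole list.
  onesL : List Bool → List A → List A
  onesL [] _ = []
  onesL (_ ∷ _) [] = []
  onesL (true ∷ bs) (x ∷ xs) = x ∷ onesL bs xs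
  onesL (false ∷ bs) (x ∷ xs) = onesL bs xs

  zerosL : List Bool → List A → List A
  zerosL [] xs = xs
  zerosL (_ ∷ _) [] = []
  zerosL (true ∷ bs) (x ∷ xs) = zerosL bs xs
  zerosL (false ∷ bs) (x ∷ xs) = x ∷ zerosL bs xs

  mtdrlL : List Bool → List A → List A
  mtdrlL bs xs = onesL bs xs ++ reverse (zerosL bs xs)

  ones-toList : ∀ {n} (v : Vec A n) b → ones v b ≡ onesL (V.toList b) (V.toList v)
  ones-toList V.[] V.[] = refl
  ones-toList (x V.∷ v) (true V.∷ b) = cong (x ∷_) (ones-toList v b)
  ones-toList (x V.∷ v) (false V.∷ b) = ones-toList v b

  zeros-toList : ∀ {n} (v : Vec A n) b → zeros v b ≡ zerosL (V.toList b) (V.toList v)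
  zeros-toList V.[] V.[] = refl
  zeros-toList (x V.∷ v) (true V.∷ b) = zeros-toList v b
  zeros-toList (x V.∷ v) (false V.∷ b) = cong (x ∷_) (zeros-toList v b)

  mtdrl-toList : ∀ {n} (v : Vec A n) b → mtdrl v b ≡ mtdrlL (V.toList b) (V.toList v)
  mtdrl-toList v b = cong₂ (λ o z → o ++ reverse z) (ones-toList v b) (zeros-toList v b)

  mtdrlL-[] : ∀ bs → mtdrlL bs [] ≡ []
  mtdrlL-[] [] = refl
  mtdrlL-[] (_ ∷ _) = refl

  mtdrlL-unset : ∀ bs x xs → mtdrlL (false ∷ bs) (x ∷ xs) ≡ mtdrlL bs xs ∷ʳ x
  mtdrlL-unset bs x xs = begin
    onesL bs xs ++ reverse (x ∷ zerosL bs xs)    ≡⟨ cong (onesL bs xs ++_) (LP.unfold-reverse x (zerosL bs xs)) ⟩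
    onesL bs xs ++ (reverse (zerosL bs xs) ∷ʳ x) ≡⟨ LP.++-assoc (onesL bs xs) _ [ x ] ⟨
    mtdrlL bs xs ∷ʳ x                            ∎
    where open ≡-Reasoning

  -- Whatever its bit, the last entry x of a list ends up directly behind the
  -- selected entries: if it is selected it is the last of them, otherwise it
  -- is the first of the reversed unselected ones.
  mtdrlL-last : ∀ bs (M : List A) x →
    mtdrlL bs (M ∷ʳ x) ≡ onesL bs M ++ x ∷ reverse (zerosL bs M)
  mtdrlL-last [] M x = LP.reverse-++ M [ x ]
  mtdrlL-last (true ∷ bs) [] x = cong (x ∷_) (mtdrlL-[] bs)
  mtdrlL-last (false ∷ bs) [] x = trans (mtdrlL-unset bs x []) (cong (_∷ʳ x) (mtdrlL-[] bs))
  mtdrlL-last (true ∷ bs) (y ∷ M) x = cong (y ∷_) (mtdrlL-last bs M x)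
  mtdrlL-last (false ∷ bs) (y ∷ M) x = begin
    mtdrlL (false ∷ bs) (y ∷ M ∷ʳ x)                         ≡⟨ mtdrlL-unset bs y (M ∷ʳ x) ⟩
    mtdrlL bs (M ∷ʳ x) ∷ʳ y                                  ≡⟨ cong (_∷ʳ y) (mtdrlL-last bs M x) ⟩
    (onesL bs M ++ x ∷ reverse (zerosL bs M)) ∷ʳ y           ≡⟨ LP.++-assoc (onesL bs M) _ [ y ] ⟩
    onesL bs M ++ x ∷ (reverse (zerosL bs M) ∷ʳ y)           ≡⟨ cong (λ t → onesL bs M ++ x ∷ t) (LP.unfold-reverse y (zerosL bs M)) ⟨
    onesL bs M ++ x ∷ reverse (y ∷ zerosL bs M)              ∎
    where open ≡-Reasoning

  ones-empty : ∀ bs (xs : List A) → onesL bs xs ≡ [] → zerosL bs xs ≡ xs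
  ones-empty [] xs _ = refl
  ones-empty (_ ∷ _) [] _ = refl
  ones-empty (false ∷ bs) (x ∷ xs) e = cong (x ∷_) (ones-empty bs xs e)

  pin-head : ∀ {x : A} {π′} O T → All (x ≢_) π′ → x ∷ π′ ≡ O ++ x ∷ T → O ≡ [] × π′ ≡ T
  pin-head [] T _ e = refl , LP.∷-injectiveʳ e
  pin-head {x} (y ∷ O) T x∉π′ e =
    ⊥-elim (All.lookup x∉π′ (subst (x ∈_) (sym (LP.∷-injectiveʳ e)) (MP.∈-++⁺ʳ O (here refl))) refl)

  reverseFrom : ℕ → List A → List A
  reverseFrom zero xs = reverse xs
  reverseFrom (suc k) [] = []
  reverseFrom (suc k) (x ∷ xs) = x ∷ reverseFrom k xs

  -- Case b₁ = 0 of step (2): x is the last entry of ρ, so returning to π (whose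
  -- head is x) selects nothing from ρ and reverses it; hence ρ = reverse π.
  unset-head : ∀ bs cs x (π′ : List A) → All (x ≢_) π′ →
    mtdrlL cs (mtdrlL (false ∷ bs) (x ∷ π′)) ≡ x ∷ π′ →
    mtdrlL (false ∷ bs) (x ∷ π′) ≡ reverse (x ∷ π′)
  unset-head bs cs x π′ x∉π′ e = begin
    mtdrlL (false ∷ bs) (x ∷ π′) ≡⟨ mtdrlL-unset bs x π′ ⟩
    M ∷ʳ x                       ≡⟨ cong (_∷ʳ x) (LP.reverse-involutive M) ⟨
    reverse (reverse M) ∷ʳ x     ≡⟨ cong (λ t → reverse t ∷ʳ x) π′≡reverse-M ⟨
    reverse π′ ∷ʳ x              ≡⟨ LP.unfold-reverse x π′ ⟨
    reverse (x ∷ π′)             ∎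
    where
      open ≡-Reasoning
      M : List A
      M = mtdrlL bs π′
      back : x ∷ π′ ≡ onesL cs M ++ x ∷ reverse (zerosL cs M)
      back = trans (sym e) (trans (cong (mtdrlL cs) (mtdrlL-unset bs x π′)) (mtdrlL-last cs M x))
      π′≡reverse-M : π′ ≡ reverse M
      π′≡reverse-M = let (nothing-selected , π′≡) = pin-head (onesL cs M) _ x∉π′ back
                     in trans π′≡ (cong reverse (ones-empty cs M nothing-selected))

  -- Case b₁ = 1, c₁ = 0 of step (2): x becomes the last entry of π, which forces
  -- π = [x] and hence ρ = [x] = r₁(π).
  set-then-unset-head : ∀ bs cs x (π′ : List A) → All (x ≢_) π′ →
    mtdrlL (false ∷ cs) (mtdrlL (true ∷ bs) (x ∷ π′)) ≡ x ∷ π′ →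
    mtdrlL (true ∷ bs) (x ∷ π′) ≡ reverseFrom 1 (x ∷ π′)
  set-then-unset-head bs cs x π′ x∉π′ e =
    cong (x ∷_) (subst (λ t → mtdrlL bs t ≡ reverse t) (sym π′≡[]) (mtdrlL-[] bs))
    where
      π′≡[] : π′ ≡ []
      π′≡[] = proj₂ (pin-head (mtdrlL cs (mtdrlL bs π′)) [] x∉π′
                (trans (sym e) (mtdrlL-unset cs x (mtdrlL bs π′))))

  -- Step (2): two MTDRLs that undo each other on a repetition-free list π
  -- produce some rₖ(π).  A missing bit is a 0 bit, so the empty patterns are
  -- handled by the 0-bit cases.
  mtdrl-round-trip : ∀ bs cs (π : List A) → Unique π → mtdrlL cs (mtdrlL bs π) ≡ π →
    ∃ λ k → mtdrlL bs π ≡ reverseFrom k π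
  mtdrl-round-trip bs cs [] _ _ = 0 , mtdrlL-[] bs
  mtdrl-round-trip [] cs (x ∷ π′) (x∉π′ ∷ _) e = 0 , unset-head [] cs x π′ x∉π′ e
  mtdrl-round-trip (false ∷ bs) cs (x ∷ π′) (x∉π′ ∷ _) e = 0 , unset-head bs cs x π′ x∉π′ e
  mtdrl-round-trip (true ∷ bs) [] (x ∷ π′) (x∉π′ ∷ _) e = 1 , set-then-unset-head bs [] x π′ x∉π′ e
  mtdrl-round-trip (true ∷ bs) (false ∷ cs) (x ∷ π′) (x∉π′ ∷ _) e = 1 , set-then-unset-head bs cs x π′ x∉π′ e
  mtdrl-round-trip (true ∷ bs) (true ∷ cs) (x ∷ π′) (_ ∷ u) e =
    let (k , ρ′≡) = mtdrl-round-trip bs cs π′ u (LP.∷-injectiveʳ e) in suc k , cong (x ∷_) ρ′≡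

  reverseFrom-↭ : ∀ k (xs : List A) → reverseFrom k xs ↭ xs
  reverseFrom-↭ zero xs = ↭-reverse xs
  reverseFrom-↭ (suc k) [] = ↭-refl
  reverseFrom-↭ (suc k) (x ∷ xs) = ↭-prep x (reverseFrom-↭ k xs)

  unique-reverseFrom : ∀ k (xs : List A) → Unique xs → Unique (reverseFrom k xs)
  unique-reverseFrom k xs = PermS.Unique-resp-↭ (setoid A) (↭⇒↭ₛ (↭-sym (reverseFrom-↭ k xs)))

  head-of-++ : ∀ (xs ys : List A) {z t} → xs ++ ys ≡ z ∷ t → xs ≡ [] ⊎ z ∈ xs
  head-of-++ [] ys e = inj₁ refl
  head-of-++ (x ∷ xs) ys e = inj₂ (here (sym (LP.∷-injectiveˡ e)))

  -- At the first position
  -- where the indices differ, rᵢ starts with an entry of the reversed tail while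
  -- rⱼ starts with the current head, which does not occur in that tail.
  reverseFrom-injective : ∀ i j (xs : List A) → Unique xs → i < j → j < length xs →
    reverseFrom i xs ≢ reverseFrom j xs
  reverseFrom-injective zero (suc j) (x ∷ xs) (x∉xs ∷ _) _ (s≤s j<n) e
    with head-of-++ (reverse xs) [ x ] (trans (sym (LP.unfold-reverse x xs)) e)
  ... | inj₁ rev≡[] = n≮0 (subst (λ l → j < length l) (LP.reverse-injective {x = xs} {y = []} rev≡[]) j<n)
  ... | inj₂ x∈rev = All.lookup x∉xs (∈-resp-↭ (↭-reverse xs) x∈rev) refl
  reverseFrom-injective (suc i) (suc j) (x ∷ xs) (_ ∷ u) (s≤s i<j) (s≤s j<n) e =
    reverseFrom-injective i j xs u i<j j<n (LP.∷-injectiveʳ e)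

  reverseFromᵛ : ∀ {n} → ℕ → Vec A n → Vec A n
  reverseFromᵛ zero v = V.reverse v
  reverseFromᵛ (suc k) V.[] = V.[]
  reverseFromᵛ (suc k) (x V.∷ v) = x V.∷ reverseFromᵛ k v

  toList-reverseFromᵛ : ∀ {n} k (v : Vec A n) → V.toList (reverseFromᵛ k v) ≡ reverseFrom k (V.toList v)
  toList-reverseFromᵛ zero v = VP.toList-reverse v
  toList-reverseFromᵛ (suc k) V.[] = refl
  toList-reverseFromᵛ (suc k) (x V.∷ v) = cong (x ∷_) (toList-reverseFromᵛ k v)

  reverseFromᵛ-involutive : ∀ {n} k (v : Vec A n) → reverseFromᵛ k (reverseFromᵛ k v) ≡ v
  reverseFromᵛ-involutive zero v = VP.reverse-involutive v
  reverseFromᵛ-involutive (suc k) V.[] = refl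
  reverseFromᵛ-involutive (suc k) (x V.∷ v) = cong (x V.∷_) (reverseFromᵛ-involutive k v)

  -- Reversing at most one entry changes nothing: rₖ(v) = v for k ≥ n - 1.
  reverseFromᵛ-saturated : ∀ {n} k (v : Vec A n) → n ≤ suc k → reverseFromᵛ k v ≡ v
  reverseFromᵛ-saturated zero V.[] _ = refl
  reverseFromᵛ-saturated zero (x V.∷ V.[]) _ = refl
  reverseFromᵛ-saturated zero (x V.∷ y V.∷ v) (s≤s ())
  reverseFromᵛ-saturated (suc k) V.[] _ = refl
  reverseFromᵛ-saturated (suc k) (x V.∷ v) (s≤s n≤1+k) = cong (x V.∷_) (reverseFromᵛ-saturated k v n≤1+k)

  ones-unset : ∀ {n} (v : Vec A n) → ones v (V.replicate n false) ≡ []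
  ones-unset V.[] = refl
  ones-unset (x V.∷ v) = ones-unset v

  zeros-unset : ∀ {n} (v : Vec A n) → zeros v (V.replicate n false) ≡ V.toList v
  zeros-unset V.[] = refl
  zeros-unset (x V.∷ v) = cong (x ∷_) (zeros-unset v)

  mtdrl-prefixPattern : ∀ {n} k (v : Vec A n) → mtdrl v (prefixPattern k n) ≡ V.toList (reverseFromᵛ k v)
  mtdrl-prefixPattern zero v =
    trans (cong₂ (λ o z → o ++ reverse z) (ones-unset v) (zeros-unset v)) (sym (VP.toList-reverse v))
  mtdrl-prefixPattern (suc k) V.[] = refl
  mtdrl-prefixPattern (suc k) (x V.∷ v) = cong (x ∷_) (mtdrl-prefixPattern k v)

  toList-injective : ∀ {n} (v w : Vec A n) → V.toList v ≡ V.toList w → v ≡ w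
  toList-injective v w e = trans (sym (VP.cast-is-id refl v)) (VP.toList-injective refl v w e)

  unique-toList : ∀ {n} {v : Vec A n} → VU.Unique v → Unique (V.toList v)
  unique-toList [] = []
  unique-toList (x∉v ∷ u) = VAll.toList⁺ x∉v ∷ unique-toList u

  unique-fromList : ∀ {n} (v : Vec A n) → Unique (V.toList v) → VU.Unique v
  unique-fromList V.[] [] = []
  unique-fromList (x V.∷ v) (x∉v ∷ u) = VAll.toList⁻ x∉v ∷ unique-fromList v u

  injective⇒unique : ∀ {n} (v : Vec A n) → (∀ i j → V.lookup v i ≡ V.lookup v j → i ≡ j) → Unique (V.toList v)
  injective⇒unique v inj = unique-toList (subst VU.Unique (VP.tabulate∘lookup v) (VUP.tabulate⁺ (inj _ _)))

  unique⇒injective : ∀ {n} (v : Vec A n) → Unique (V.toList v) → ∀ i j → V.lookup v i ≡ V.lookup v j → i ≡ j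
  unique⇒injective v u = VUP.lookup-injective (unique-fromList v u)

  reverseFromᵛ-injective : ∀ {n} (v : Vec A n) → Unique (V.toList v) → ∀ {i j} → i < j → j < n →
    reverseFromᵛ i v ≢ reverseFromᵛ j v
  reverseFromᵛ-injective v u {i} {j} i<j j<n e =
    reverseFrom-injective i j (V.toList v) u i<j (subst (j <_) (sym (VP.length-toList v)) j<n)
      (trans (sym (toList-reverseFromᵛ i v)) (trans (cong V.toList e) (toList-reverseFromᵛ j v)))

  -- Every rₖ(v) already occurs among r₀(v), …, rₙ₋₁(v), as rₖ(v) = v = rₙ₋₁(v) for k ≥ n.
  reverseFromᵛ-listed : ∀ {m} (v : Vec A (suc m)) k →
    reverseFromᵛ k v ∈ applyUpTo (λ j → reverseFromᵛ j v) (suc m)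
  reverseFromᵛ-listed {m} v k with k <? suc m
  ... | yes k<n = MP.∈-applyUpTo⁺ (λ j → reverseFromᵛ j v) k<n
  ... | no k≮n = subst (_∈ applyUpTo (λ j → reverseFromᵛ j v) (suc m))
                   (trans (reverseFromᵛ-saturated m v ≤-refl)
                          (sym (reverseFromᵛ-saturated k v (≤-trans (≮⇒≥ k≮n) (n≤1+n k)))))
                   (MP.∈-applyUpTo⁺ (λ j → reverseFromᵛ j v) ≤-refl)

reverseFrom-inBoth : ∀ {n} k (π : Vec (Fin n) n) → IsPerm n π → InBoth π (reverseFromᵛ k π)
reverseFrom-inBoth {n} k π perm =
  (prefixPattern k n , mtdrl-prefixPattern k π) ,
  (unique⇒injective ρ ρ-unique ,
   (prefixPattern k n , trans (mtdrl-prefixPattern k ρ) (cong V.toList (reverseFromᵛ-involutive k π))))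
  where
    ρ : Vec (Fin n) n
    ρ = reverseFromᵛ k π
    ρ-unique : Unique (V.toList ρ)
    ρ-unique = subst Unique (sym (toList-reverseFromᵛ k π)) (unique-reverseFrom k _ (injective⇒unique π perm))

inBoth⇒reverseFrom : ∀ {n} (π ρ : Vec (Fin n) n) → IsPerm n π → InBoth π ρ →
  ∃ λ k → ρ ≡ reverseFromᵛ k π
inBoth⇒reverseFrom π ρ perm ((b , π↦ρ) , (_ , (c , ρ↦π))) =
  let (k , ρ≡rₖ) = mtdrl-round-trip (V.toList b) (V.toList c) (V.toList π) (injective⇒unique π perm) round-trip
  in k , toList-injective ρ (reverseFromᵛ k π) (trans (sym ρ-list) (trans ρ≡rₖ (sym (toList-reverseFromᵛ k π))))
  where
    ρ-list : mtdrlL (V.toList b) (V.toList π) ≡ V.toList ρ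
    ρ-list = trans (sym (mtdrl-toList π b)) π↦ρ
    round-trip : mtdrlL (V.toList c) (mtdrlL (V.toList b) (V.toList π)) ≡ V.toList π
    round-trip = trans (cong (mtdrlL (V.toList c)) ρ-list) (trans (sym (mtdrl-toList ρ c)) ρ↦π)

theorem7 : (n : ℕ) → 1 ≤ n → (π : Vec (Fin n) n) → IsPerm n π →
    HasCard (InBoth π) n
theorem7 n@(suc _) _ π perm =
  rotations , distinct , LP.length-applyUpTo r n , λ ρ → mk⇔ (listed⇒inBoth ρ) (inBoth⇒listed ρ)
  where
    r : ℕ → Vec (Fin n) n
    r k = reverseFromᵛ k π
    rotations : List (Vec (Fin n) n)
    rotations = applyUpTo r n
    distinct : Unique rotations
    distinct = UP.applyUpTo⁺₁ r n (reverseFromᵛ-injective π (injective⇒unique π perm))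
    listed⇒inBoth : ∀ ρ → ρ ∈ rotations → InBoth π ρ
    listed⇒inBoth ρ ρ∈ with MP.∈-applyUpTo⁻ r ρ∈
    ... | k , _ , refl = reverseFrom-inBoth k π perm
    inBoth⇒listed : ∀ ρ → InBoth π ρ → ρ ∈ rotations
    inBoth⇒listed ρ ρ∈ with inBoth⇒reverseFrom π ρ perm ρ∈
    ... | k , refl = reverseFromᵛ-listed π k
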